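{- Let $G^+=(V,E^+)$ be a finite simple undirected graph, $\phi\ge0$, $0\le\eta<1$, and let $\mathcal{C}^*$ be a clustering with $\mathrm{obj}(\mathcal{C}^*)\le\phi$. Let $u,v$ be vertices with $\deg(u),\deg(v)>(3+\eta)\phi$ and $\mathcal{C}^*_u\ne\mathcal{C}^*_v$, and let $w$ be a vertex with $\deg(w)\le(3+\eta)\phi$. If $w\in\mathcal{C}^*_u$, then $|N[v]\Delta N[w]|>(1+\eta)2\phi$. In particular, any $\eta$-similarity query $\Delta_\eta(v,w,2\phi)$ returns $0$.
   Context: For $u\in V$, $N(u)$ is the set of neighbours of $u$ in $G^+$, $\deg(u)=|N(u)|$, and $N[u]=N(u)\cup\{u\}$. $\Delta$ denotes symmetric difference. A clustering $\mathcal{C}$ is a partition of $V$, and $\mathcal{C}_u$ denotes the cluster containing $u$. The disagreement of $u$ is $\rho_{\mathcal{C}}(u)=|N[u]\Delta\mathcal{C}_u|$, and $\mathrm{obj}(\mathcal{C})=\max_u\rho_{\mathcal{C}}(u)$. An $\eta$-similarity query $\Delta_{\eta}(u,v,t)$ returns: - $0$ if $|N[u]\Delta N[v]|>(1+\eta)t$; - $1$ if $|N[u]\Delta N[v]|\le t$; - arbitrarily $0$ or $1$ otherwise.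
   Formalization: The parameters φ and η range over the rationals. -}

module Defs where

open import Data.Nat using (ℕ)
open import Data.Bool using (Bool; true; false)
open import Data.Fin using (Fin; _≟_)
open import Data.Fin.Subset using (Subset; ⁅_⁆; _∪_; _─_; ∣_∣)
open import Data.Vec using (tabulate)
open import Data.Product using (_×_)
open import Data.Integer using (+_)
open import Data.Rational using (ℚ; _/_; _+_; _*_; _≤_; _<_; 1ℚ)
open import Relation.Nullary.Decidable using (⌊_⌋)
open import Relation.Binary.PropositionalEquality using (_≡_)

record Graph (n : ℕ) : Set where
  field
    adj   : Fin n → Fin n → Bool
    sym   : ∀ x y → adj x y ≡ adj y x
    irrefl : ∀ x → adj x x ≡ false
open Graph public

ℕ→ℚ : ℕ → ℚ
ℕ→ℚ k = + k / 1

_Δ_ : ∀ {n} → Subset n → Subset n → Subset n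
A Δ B = (A ─ B) ∪ (B ─ A)

module _ {n : ℕ} (G : Graph n) where
  N : Fin n → Subset n
  N u = tabulate (λ x → adj G u x)

  deg : Fin n → ℕ
  deg u = ∣ N u ∣

  N[_] : Fin n → Subset n
  N[ u ] = N u ∪ ⁅ u ⁆

-- A clustering (partition of V) is represented by a cluster-label map;
-- two vertices are in the same cluster iff they have the same label.
Clustering : ℕ → Set
Clustering n = Fin n → Fin n

clusterOf : ∀ {n} → Clustering n → Fin n → Subset n
clusterOf C u = tabulate (λ x → ⌊ C x ≟ C u ⌋)

ρ : ∀ {n} → Graph n → Clustering n → Fin n → ℕ
ρ G C u = ∣ N[_] G u Δ clusterOf C u ∣

-- obj(𝒞) ≤ φ  (obj is the maximum of ρ over vertices)
ObjAtMost : ∀ {n} → Graph n → Clustering n → ℚ → Set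
ObjAtMost G C φ = ∀ u → ℕ→ℚ (ρ G C u) ≤ φ

nbDist : ∀ {n} → Graph n → Fin n → Fin n → ℕ
nbDist G u v = ∣ N[_] G u Δ N[_] G v ∣

IsSimilarityQuery : ∀ {n} → Graph n → ℚ → (Fin n → Fin n → ℚ → Bool) → Set
IsSimilarityQuery G η Q =
  ∀ u v t →
    ((1ℚ + η) * t < ℕ→ℚ (nbDist G u v) → Q u v t ≡ false) ×
    (ℕ→ℚ (nbDist G u v) ≤ t → Q u v t ≡ true)

{-# OPTIONS --safe #-}
-- N[u] lies within φ of 𝒞_u and N[v] within φ of 𝒞_v, so deg u + deg v ≤ 2φ + |𝒞_u| + |𝒞_v|.
-- The clusters are disjoint, so |𝒞_u| + |𝒞_v| = |𝒞_u Δ 𝒞_v|, and the triangle inequality for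
-- |_ Δ _| along 𝒞_u, N[w], N[v], 𝒞_v bounds this by ρ(w) + |N[v] Δ N[w]| + ρ(v).
-- Hence 2(3+η)φ < deg u + deg v ≤ 4φ + |N[v] Δ N[w]|.
module Submission where

open import Defs
open import Data.Nat using (ℕ)
open import Data.Bool using (Bool; false)
open import Data.Fin using (Fin)
open import Data.Fin.Subset using (_∈_)
open import Data.Product using (_×_)
open import Data.Rational using (ℚ; _+_; _*_; _≤_; _<_; 0ℚ; 1ℚ)
open import Relation.Binary.PropositionalEquality using (_≡_; _≢_)

open import Data.Bool using (true; T)
open import Data.Fin using (_≟_)
open import Data.Fin.Subset using (Subset; ∣_∣; _∩_; _─_; ⁅_⁆; Empty)
open import Data.Fin.Subset.Properties using (∣p∣≤∣p∪q∣; ∪-comm; x∈p∩q⁻; drop-∷-Empty)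
open import Data.Nat as ℕ using (z≤n; s≤s)
import Data.Nat.Properties as ℕ
open import Algebra.Properties.CommutativeSemigroup ℕ.+-commutativeSemigroup
  using (interchange; xy∙z≈xz∙y)
open import Data.Nat.Coprimality using (1-coprimeTo) renaming (sym to coprime-sym)
import Data.Integer as ℤ
import Data.Integer.Properties as ℤ
open import Data.Rational using (mkℚ; *≤*; _/_)
open import Data.Rational.Properties
  using (module ≤-Reasoning; normalize-coprime; /-cong; +-mono-≤; +-monoʳ-≤; +-mono-<; ≤-refl; _≤?_; ≰⇒>; <-irrefl; <-≤-trans)
open import Data.Rational.Solver using (module +-*-Solver)
open import Data.Vec using (_∷_; []; tabulate; here)
open import Data.Vec.Properties using ([]=⇒lookup; lookup∘tabulate)
open import Data.Product using (_,_; proj₁)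
open import Relation.Nullary using (yes; no; contradiction)
open import Relation.Nullary.Decidable using (⌊_⌋; toWitness)
open import Relation.Binary.PropositionalEquality using (refl; trans; cong; cong₂; subst; module ≡-Reasoning)
  renaming (sym to ≡-sym)

∣pΔq∣≡∣qΔp∣ : ∀ {n} (p q : Subset n) → ∣ p Δ q ∣ ≡ ∣ q Δ p ∣
∣pΔq∣≡∣qΔp∣ p q = cong ∣_∣ (∪-comm (p ─ q) (q ─ p))

private
  suc-+ʳ : ∀ {c} a b → c ℕ.≤ a ℕ.+ b → ℕ.suc c ℕ.≤ a ℕ.+ ℕ.suc b
  suc-+ʳ a b c≤a+b = ℕ.≤-trans (s≤s c≤a+b) (ℕ.≤-reflexive (≡-sym (ℕ.+-suc a b)))

  weaken-+ : ∀ {c} a b → c ℕ.≤ a ℕ.+ b → c ℕ.≤ ℕ.suc a ℕ.+ ℕ.suc b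
  weaken-+ a b c≤a+b = ℕ.≤-trans c≤a+b (ℕ.+-mono-≤ (ℕ.n≤1+n a) (ℕ.n≤1+n b))

∣p∣≤∣pΔq∣+∣q∣ : ∀ {n} (p q : Subset n) → ∣ p ∣ ℕ.≤ ∣ p Δ q ∣ ℕ.+ ∣ q ∣
∣p∣≤∣pΔq∣+∣q∣ [] [] = z≤n
∣p∣≤∣pΔq∣+∣q∣ (false ∷ p) (false ∷ q) = ∣p∣≤∣pΔq∣+∣q∣ p q
∣p∣≤∣pΔq∣+∣q∣ (false ∷ p) (true  ∷ q) = weaken-+ _ _ (∣p∣≤∣pΔq∣+∣q∣ p q)
∣p∣≤∣pΔq∣+∣q∣ (true  ∷ p) (false ∷ q) = s≤s (∣p∣≤∣pΔq∣+∣q∣ p q)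
∣p∣≤∣pΔq∣+∣q∣ (true  ∷ p) (true  ∷ q) = suc-+ʳ _ _ (∣p∣≤∣pΔq∣+∣q∣ p q)

∣pΔr∣≤∣pΔq∣+∣qΔr∣ : ∀ {n} (p q r : Subset n) → ∣ p Δ r ∣ ℕ.≤ ∣ p Δ q ∣ ℕ.+ ∣ q Δ r ∣
∣pΔr∣≤∣pΔq∣+∣qΔr∣ [] [] [] = z≤n
∣pΔr∣≤∣pΔq∣+∣qΔr∣ (false ∷ p) (false ∷ q) (false ∷ r) = ∣pΔr∣≤∣pΔq∣+∣qΔr∣ p q r
∣pΔr∣≤∣pΔq∣+∣qΔr∣ (false ∷ p) (false ∷ q) (true  ∷ r) = suc-+ʳ _ _ (∣pΔr∣≤∣pΔq∣+∣qΔr∣ p q r)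
∣pΔr∣≤∣pΔq∣+∣qΔr∣ (false ∷ p) (true  ∷ q) (false ∷ r) = weaken-+ _ _ (∣pΔr∣≤∣pΔq∣+∣qΔr∣ p q r)
∣pΔr∣≤∣pΔq∣+∣qΔr∣ (false ∷ p) (true  ∷ q) (true  ∷ r) = s≤s (∣pΔr∣≤∣pΔq∣+∣qΔr∣ p q r)
∣pΔr∣≤∣pΔq∣+∣qΔr∣ (true  ∷ p) (false ∷ q) (false ∷ r) = s≤s (∣pΔr∣≤∣pΔq∣+∣qΔr∣ p q r)
∣pΔr∣≤∣pΔq∣+∣qΔr∣ (true  ∷ p) (false ∷ q) (true  ∷ r) = weaken-+ _ _ (∣pΔr∣≤∣pΔq∣+∣qΔr∣ p q r)
∣pΔr∣≤∣pΔq∣+∣qΔr∣ (true  ∷ p) (true  ∷ q) (false ∷ r) = suc-+ʳ _ _ (∣pΔr∣≤∣pΔq∣+∣qΔr∣ p q r)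
∣pΔr∣≤∣pΔq∣+∣qΔr∣ (true  ∷ p) (true  ∷ q) (true  ∷ r) = ∣pΔr∣≤∣pΔq∣+∣qΔr∣ p q r

Empty[p∩q]⇒∣p∣+∣q∣≤∣pΔq∣ : ∀ {n} (p q : Subset n) → Empty (p ∩ q) → ∣ p ∣ ℕ.+ ∣ q ∣ ℕ.≤ ∣ p Δ q ∣
Empty[p∩q]⇒∣p∣+∣q∣≤∣pΔq∣ [] [] _ = z≤n
Empty[p∩q]⇒∣p∣+∣q∣≤∣pΔq∣ (false ∷ p) (false ∷ q) e = Empty[p∩q]⇒∣p∣+∣q∣≤∣pΔq∣ p q (drop-∷-Empty e)
Empty[p∩q]⇒∣p∣+∣q∣≤∣pΔq∣ (false ∷ p) (true  ∷ q) e =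
  ℕ.≤-trans (ℕ.≤-reflexive (ℕ.+-suc ∣ p ∣ ∣ q ∣)) (s≤s (Empty[p∩q]⇒∣p∣+∣q∣≤∣pΔq∣ p q (drop-∷-Empty e)))
Empty[p∩q]⇒∣p∣+∣q∣≤∣pΔq∣ (true  ∷ p) (false ∷ q) e = s≤s (Empty[p∩q]⇒∣p∣+∣q∣≤∣pΔq∣ p q (drop-∷-Empty e))
Empty[p∩q]⇒∣p∣+∣q∣≤∣pΔq∣ (true  ∷ p) (true  ∷ q) e = contradiction (_ , here) e

ℕ→ℚ≡mkℚ : ∀ k → ℕ→ℚ k ≡ mkℚ (ℤ.+ k) 0 (coprime-sym (1-coprimeTo k))
ℕ→ℚ≡mkℚ k = normalize-coprime (coprime-sym (1-coprimeTo k))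

ℕ→ℚ-mono-≤ : ∀ {a b} → a ℕ.≤ b → ℕ→ℚ a ≤ ℕ→ℚ b
ℕ→ℚ-mono-≤ {a} {b} a≤b rewrite ℕ→ℚ≡mkℚ a | ℕ→ℚ≡mkℚ b =
  *≤* (ℤ.*-monoʳ-≤-nonNeg (ℤ.+ 1) (ℤ.+≤+ a≤b))

ℕ→ℚ-homo-+ : ∀ a b → ℕ→ℚ (a ℕ.+ b) ≡ ℕ→ℚ a + ℕ→ℚ b
ℕ→ℚ-homo-+ a b = begin
  ℤ.+ (a ℕ.+ b) / 1                                 ≡⟨ /-cong numerator refl ⟩
  (ℤ.+ a ℤ.* ℤ.+ 1 ℤ.+ ℤ.+ b ℤ.* ℤ.+ 1) / 1          ≡⟨ cong₂ _+_ (ℕ→ℚ≡mkℚ a) (ℕ→ℚ≡mkℚ b) ⟨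
  ℕ→ℚ a + ℕ→ℚ b                                     ∎
  where
  open ≡-Reasoning
  numerator : ℤ.+ (a ℕ.+ b) ≡ ℤ.+ a ℤ.* ℤ.+ 1 ℤ.+ ℤ.+ b ℤ.* ℤ.+ 1
  numerator = trans (ℤ.pos-+ a b) (≡-sym (cong₂ ℤ._+_ (ℤ.*-identityʳ (ℤ.+ a)) (ℤ.*-identityʳ (ℤ.+ b))))

ℕ→ℚ-+-mono-≤ : ∀ a b {p q} → ℕ→ℚ a ≤ p → ℕ→ℚ b ≤ q → ℕ→ℚ (a ℕ.+ b) ≤ p + q
ℕ→ℚ-+-mono-≤ a b a≤p b≤q = subst (_≤ _) (≡-sym (ℕ→ℚ-homo-+ a b)) (+-mono-≤ a≤p b≤q)

+-cancelˡ-< : ∀ r {p q} → r + p < r + q → p < q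
+-cancelˡ-< r {p} {q} r+p<r+q with q ≤? p
... | yes q≤p = contradiction (<-≤-trans r+p<r+q (+-monoʳ-≤ r q≤p)) (<-irrefl refl)
... | no q≰p = ≰⇒> q≰p

module _ {n : ℕ} (C : Clustering n) where

  clusterOf-cong : ∀ {u v} → C u ≡ C v → clusterOf C u ≡ clusterOf C v
  clusterOf-cong = cong (λ c → tabulate (λ x → ⌊ C x ≟ c ⌋))

  ∈-clusterOf⁻ : ∀ {u x} → x ∈ clusterOf C u → C x ≡ C u
  ∈-clusterOf⁻ {u} {x} x∈𝒞u = toWitness (subst T (≡-sym x-has-label-Cu) _)
    where
    x-has-label-Cu : ⌊ C x ≟ C u ⌋ ≡ true
    x-has-label-Cu = trans (≡-sym (lookup∘tabulate (λ y → ⌊ C y ≟ C u ⌋) x)) ([]=⇒lookup x∈𝒞u)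

  distinct-clusters-disjoint : ∀ {u v} → clusterOf C u ≢ clusterOf C v →
                               Empty (clusterOf C u ∩ clusterOf C v)
  distinct-clusters-disjoint 𝒞u≢𝒞v (x , x∈𝒞u∩𝒞v) =
    let x∈𝒞u , x∈𝒞v = x∈p∩q⁻ _ _ x∈𝒞u∩𝒞v
    in 𝒞u≢𝒞v (clusterOf-cong (trans (≡-sym (∈-clusterOf⁻ x∈𝒞u)) (∈-clusterOf⁻ x∈𝒞v)))

module _ {n : ℕ} (G : Graph n) (C : Clustering n) where

  deg≤ρ+∣cluster∣ : ∀ x → deg G x ℕ.≤ ρ G C x ℕ.+ ∣ clusterOf C x ∣
  deg≤ρ+∣cluster∣ x = ℕ.≤-trans (∣p∣≤∣p∪q∣ (N G x) ⁅ x ⁆) (∣p∣≤∣pΔq∣+∣q∣ (N[_] G x) (clusterOf C x))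

  module _ {u v w : Fin n} (𝒞u≢𝒞v : clusterOf C u ≢ clusterOf C v) (w∈𝒞u : w ∈ clusterOf C u) where

    private
      𝒞u = clusterOf C u
      𝒞v = clusterOf C v

    ∣cluster∣+∣cluster∣≤ρ+ρ+nbDist :
      ∣ 𝒞u ∣ ℕ.+ ∣ 𝒞v ∣ ℕ.≤ (ρ G C w ℕ.+ ρ G C v) ℕ.+ nbDist G v w
    ∣cluster∣+∣cluster∣≤ρ+ρ+nbDist = begin
      ∣ 𝒞u ∣ ℕ.+ ∣ 𝒞v ∣
        ≤⟨ Empty[p∩q]⇒∣p∣+∣q∣≤∣pΔq∣ 𝒞u 𝒞v (distinct-clusters-disjoint C 𝒞u≢𝒞v) ⟩
      ∣ 𝒞u Δ 𝒞v ∣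
        ≤⟨ ∣pΔr∣≤∣pΔq∣+∣qΔr∣ 𝒞u (N[_] G v) 𝒞v ⟩
      ∣ 𝒞u Δ N[_] G v ∣ ℕ.+ ρ G C v
        ≤⟨ ℕ.+-monoˡ-≤ (ρ G C v) (∣pΔr∣≤∣pΔq∣+∣qΔr∣ 𝒞u (N[_] G w) (N[_] G v)) ⟩
      (∣ 𝒞u Δ N[_] G w ∣ ℕ.+ ∣ N[_] G w Δ N[_] G v ∣) ℕ.+ ρ G C v
        ≡⟨ cong (ℕ._+ ρ G C v) (cong₂ ℕ._+_ ρw ∣N[w]ΔN[v]∣≡nbDist) ⟩
      (ρ G C w ℕ.+ nbDist G v w) ℕ.+ ρ G C v
        ≡⟨ xy∙z≈xz∙y (ρ G C w) (nbDist G v w) (ρ G C v) ⟩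
      (ρ G C w ℕ.+ ρ G C v) ℕ.+ nbDist G v w ∎
      where
      open ℕ.≤-Reasoning
      ρw : ∣ 𝒞u Δ N[_] G w ∣ ≡ ρ G C w
      ρw = trans (∣pΔq∣≡∣qΔp∣ 𝒞u (N[_] G w))
                 (cong (λ 𝒞 → ∣ N[_] G w Δ 𝒞 ∣) (≡-sym (clusterOf-cong C (∈-clusterOf⁻ C w∈𝒞u))))
      ∣N[w]ΔN[v]∣≡nbDist : ∣ N[_] G w Δ N[_] G v ∣ ≡ nbDist G v w
      ∣N[w]ΔN[v]∣≡nbDist = ∣pΔq∣≡∣qΔp∣ (N[_] G w) (N[_] G v)

    deg+deg≤ρ+ρ+ρ+ρ+nbDist :
      deg G u ℕ.+ deg G v ℕ.≤ ((ρ G C u ℕ.+ ρ G C v) ℕ.+ (ρ G C w ℕ.+ ρ G C v)) ℕ.+ nbDist G v w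
    deg+deg≤ρ+ρ+ρ+ρ+nbDist = begin
      deg G u ℕ.+ deg G v
        ≤⟨ ℕ.+-mono-≤ (deg≤ρ+∣cluster∣ u) (deg≤ρ+∣cluster∣ v) ⟩
      (ρ G C u ℕ.+ ∣ 𝒞u ∣) ℕ.+ (ρ G C v ℕ.+ ∣ 𝒞v ∣)
        ≡⟨ interchange (ρ G C u) (∣ 𝒞u ∣) (ρ G C v) (∣ 𝒞v ∣) ⟩
      (ρ G C u ℕ.+ ρ G C v) ℕ.+ (∣ 𝒞u ∣ ℕ.+ ∣ 𝒞v ∣)
        ≤⟨ ℕ.+-monoʳ-≤ (ρ G C u ℕ.+ ρ G C v) ∣cluster∣+∣cluster∣≤ρ+ρ+nbDist ⟩
      (ρ G C u ℕ.+ ρ G C v) ℕ.+ ((ρ G C w ℕ.+ ρ G C v) ℕ.+ nbDist G v w)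
        ≡⟨ ℕ.+-assoc (ρ G C u ℕ.+ ρ G C v) (ρ G C w ℕ.+ ρ G C v) (nbDist G v w) ⟨
      ((ρ G C u ℕ.+ ρ G C v) ℕ.+ (ρ G C w ℕ.+ ρ G C v)) ℕ.+ nbDist G v w ∎
      where
      open ℕ.≤-Reasoning

    deg+deg≤4φ+nbDist : ∀ {φ} → ObjAtMost G C φ →
      ℕ→ℚ (deg G u) + ℕ→ℚ (deg G v) ≤ (φ + φ) + (φ + φ) + ℕ→ℚ (nbDist G v w)
    deg+deg≤4φ+nbDist {φ} obj = begin
      ℕ→ℚ (deg G u) + ℕ→ℚ (deg G v)      ≡⟨ ℕ→ℚ-homo-+ (deg G u) (deg G v) ⟨
      ℕ→ℚ (deg G u ℕ.+ deg G v)          ≤⟨ ℕ→ℚ-mono-≤ deg+deg≤ρ+ρ+ρ+ρ+nbDist ⟩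
      ℕ→ℚ (ρ-sum ℕ.+ nbDist G v w)       ≤⟨ ℕ→ℚ-+-mono-≤ ρ-sum (nbDist G v w) ρ-sum≤4φ ≤-refl ⟩
      (φ + φ) + (φ + φ) + ℕ→ℚ (nbDist G v w) ∎
      where
      open ≤-Reasoning
      ρ+ρ≤φ+φ : ∀ x y → ℕ→ℚ (ρ G C x ℕ.+ ρ G C y) ≤ φ + φ
      ρ+ρ≤φ+φ x y = ℕ→ℚ-+-mono-≤ (ρ G C x) (ρ G C y) (obj x) (obj y)
      ρ-sum : ℕ
      ρ-sum = (ρ G C u ℕ.+ ρ G C v) ℕ.+ (ρ G C w ℕ.+ ρ G C v)
      ρ-sum≤4φ : ℕ→ℚ ρ-sum ≤ (φ + φ) + (φ + φ)
      ρ-sum≤4φ = ℕ→ℚ-+-mono-≤ (ρ G C u ℕ.+ ρ G C v) (ρ G C w ℕ.+ ρ G C v) (ρ+ρ≤φ+φ u v) (ρ+ρ≤φ+φ w v)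

2[3+η]φ≡4φ+[1+η]2φ : ∀ φ η →
  (ℕ→ℚ 3 + η) * φ + (ℕ→ℚ 3 + η) * φ ≡ (φ + φ) + (φ + φ) + (1ℚ + η) * (ℕ→ℚ 2 * φ)
2[3+η]φ≡4φ+[1+η]2φ = solve 2 (λ φ η →
  (con (ℕ→ℚ 3) :+ η) :* φ :+ (con (ℕ→ℚ 3) :+ η) :* φ
    := (φ :+ φ) :+ (φ :+ φ) :+ (con 1ℚ :+ η) :* (con (ℕ→ℚ 2) :* φ)) refl
  where open +-*-Solver

mainTheorem3 : ∀ {n : ℕ} (G : Graph n) (φ η : ℚ) (C : Clustering n) →
    0ℚ ≤ φ → 0ℚ ≤ η → η < 1ℚ →
    ObjAtMost G C φ →
    (u v w : Fin n) →
    (ℕ→ℚ 3 + η) * φ < ℕ→ℚ (deg G u) →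
    (ℕ→ℚ 3 + η) * φ < ℕ→ℚ (deg G v) →
    clusterOf C u ≢ clusterOf C v →
    ℕ→ℚ (deg G w) ≤ (ℕ→ℚ 3 + η) * φ →
    w ∈ clusterOf C u →
    ((1ℚ + η) * (ℕ→ℚ 2 * φ) < ℕ→ℚ (nbDist G v w))
    × (∀ (Q : Fin n → Fin n → ℚ → Bool) → IsSimilarityQuery G η Q →
         Q v w (ℕ→ℚ 2 * φ) ≡ false)
mainTheorem3 G φ η C _ _ _ obj u v w deg-u deg-v 𝒞u≢𝒞v _ w∈𝒞u =
  threshold<nbDist , λ Q Q-is-query → proj₁ (Q-is-query v w (ℕ→ℚ 2 * φ)) threshold<nbDist
  where
  open ≤-Reasoning
  threshold<nbDist : (1ℚ + η) * (ℕ→ℚ 2 * φ) < ℕ→ℚ (nbDist G v w)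
  threshold<nbDist = +-cancelˡ-< ((φ + φ) + (φ + φ)) (begin-strict
    (φ + φ) + (φ + φ) + (1ℚ + η) * (ℕ→ℚ 2 * φ) ≡⟨ 2[3+η]φ≡4φ+[1+η]2φ φ η ⟨
    (ℕ→ℚ 3 + η) * φ + (ℕ→ℚ 3 + η) * φ          <⟨ +-mono-< deg-u deg-v ⟩
    ℕ→ℚ (deg G u) + ℕ→ℚ (deg G v)              ≤⟨ deg+deg≤4φ+nbDist G C 𝒞u≢𝒞v w∈𝒞u obj ⟩
    (φ + φ) + (φ + φ) + ℕ→ℚ (nbDist G v w)     ∎)
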